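{- Let $\mathcal{U}_1=(E_1,\le_1,\#_1,Q_1)$ and $\mathcal{U}_2=(E_2,\le_2,\#_2,Q_2)$ be unitary event structures over $\mathcal{H}=(\mathbb{C}^2)^{\otimes N}$ and let $n\in\{1,\dots,N\}$. Then $\mathbf{meas}\,n\,(\mathcal{U}_1,\mathcal{U}_2)$ is a unitary event structure.
   Context: An event structure is $(E,\le,\#)$ with $\le$ a partial order, $\#$ symmetric irreflexive, $\{e':e'\le e\}$ finite, $e\#e'\le e''\Rightarrow e\#e''$. Events are concurrent if unrelated by $\le$ in either direction and not in conflict. Minimal conflict $e_1\rightsquigarrow e_2$: $e_1\#e_2$ and whenever $e_1'\le e_1$, $e_2'\le e_2$, $e_1'\#e_2'$ then $e_1'=e_1,e_2'=e_2$; $[e]=\{e\}\cup\{e':e\rightsquigarrow e'\}$. A unitary event structure over a finite-dimensional Hilbert space $\mathcal{H}$ is an event structure with $Q:E\to\mathrm{Op}(\mathcal{H})$ assigning each event a projection or unitary, such that concurrent events have commuting operators, $\rightsquigarrow$ is transitive, and $\sum_{e'\in[e]}Q(e')$ is unitary for all $e$. $P_0^n,P_1^n$ denote the projections of qubit $n$ onto $|0\rangle$ and $|1\rangle$ (so $P_0^n+P_1^n=Id$). Measurement $\mathbf{meas}\,n\,(\mathcal{U}_1,\mathcal{U}_2)=(E,\le,\#,Q)$: $E=\{\tau_0^n,\tau_1^n\}\uplus E_1\uplus E_2$; $\le$ consists of $\tau_0^n\le e$ for $e\in E_1$, $\tau_1^n\le e$ for $e\in E_2$, reflexivity on $\tau_0^n,\tau_1^n$,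 and $\le_1\uplus\le_2$; $e\#e'$ (symmetrically) whenever $e\in\{\tau_0^n\}\cup E_1$ and $e'\in\{\tau_1^n\}\cup E_2$, together with $\#_1\uplus\#_2$; $Q(\tau_0^n)=P_0^n$, $Q(\tau_1^n)=P_1^n$, $Q(e)=Q_1(e)$ on $E_1$, $Q(e)=Q_2(e)$ on $E_2$. -}

module Defs where

open import Level using (Level; _⊔_) renaming (suc to lsuc)
open import Algebra.Bundles using (CommutativeRing)
open import Data.Nat using (ℕ; zero; suc; _^_; _%_; _/_; _≡ᵇ_)
open import Data.Fin using (Fin; toℕ)
import Data.Fin as Fin
open import Data.Bool using (Bool; true; false; if_then_else_; _∧_)
open import Data.List using (List; foldr; map)
open import Data.List.Membership.Propositional using (_∈_)
open import Data.List.Relation.Unary.Unique.Propositional using (Unique)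
open import Data.Product using (_×_; ∃)
open import Data.Sum using (_⊎_)
open import Data.Empty using (⊥)
open import Data.Unit using (⊤)
open import Function.Bundles using (_⇔_)
open import Relation.Nullary using (¬_; does)
open import Relation.Binary.PropositionalEquality using (_≡_; _≢_)

record StarCommRing (c ℓ : Level) : Set (lsuc (c ⊔ ℓ)) where
  field
    commRing : CommutativeRing c ℓ
  open CommutativeRing commRing public
  field
    conj       : Carrier → Carrier
    conj-cong  : ∀ {x y} → x ≈ y → conj x ≈ conj y
    conj-invol : ∀ x → conj (conj x) ≈ x
    conj-+     : ∀ x y → conj (x + y) ≈ conj x + conj y
    conj-*     : ∀ x y → conj (x * y) ≈ conj x * conj y
    conj-1     : conj 1# ≈ 1#

-- Operators on H = (K^2)^{⊗N} as 2^N × 2^N matrices.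

bitAt : ℕ → ℕ → Bool
bitAt m zero    = m % 2 ≡ᵇ 1
bitAt m (suc k) = bitAt (m / 2) k

module Ops {c ℓ : Level} (S : StarCommRing c ℓ) (N : ℕ) where
  open StarCommRing S

  Dim : ℕ
  Dim = 2 ^ N

  Op : Set c
  Op = Fin Dim → Fin Dim → Carrier

  infix 4 _≈ₒ_
  _≈ₒ_ : Op → Op → Set ℓ
  A ≈ₒ B = ∀ i j → A i j ≈ B i j

  sumFin : ∀ {m} → (Fin m → Carrier) → Carrier
  sumFin {zero}  f = 0#
  sumFin {suc m} f = f Fin.zero + sumFin (λ k → f (Fin.suc k))

  0ₒ Idₒ : Op
  0ₒ i j = 0#
  Idₒ i j = if does (i Fin.≟ j) then 1# else 0#

  _+ₒ_ _*ₒ_ : Op → Op → Op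
  (A +ₒ B) i j = A i j + B i j
  (A *ₒ B) i j = sumFin (λ k → A i k * B k j)

  adj : Op → Op
  adj A i j = conj (A j i)

  sumOps : List Op → Op
  sumOps = foldr _+ₒ_ 0ₒ

  IsProjection : Op → Set ℓ
  IsProjection P = (P *ₒ P ≈ₒ P) × (adj P ≈ₒ P)

  IsUnitary : Op → Set ℓ
  IsUnitary U = (adj U *ₒ U ≈ₒ Idₒ) × (U *ₒ adj U ≈ₒ Idₒ)

  -- P_b^n : projection of qubit n (0-indexed, qubit n ↔ binary digit n
  -- of the computational-basis index) onto |b⟩.
  Proj : Bool → Fin N → Op
  Proj b n i j =
    if does (i Fin.≟ j) ∧ does (Data.Bool._≟_ (bitAt (toℕ i) (toℕ n)) b)
    then 1# else 0#

  P₀ P₁ : Fin N → Op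
  P₀ = Proj false
  P₁ = Proj true

record RawES : Set₁ where
  field
    Ev   : Set
    _≤_  : Ev → Ev → Set
    _#_  : Ev → Ev → Set

module _ (X : RawES) where
  open RawES X

  record IsEventStructure : Set where
    field
      ≤-refl    : ∀ e → e ≤ e
      ≤-trans   : ∀ {a b c} → a ≤ b → b ≤ c → a ≤ c
      ≤-antisym : ∀ {a b} → a ≤ b → b ≤ a → a ≡ b
      #-sym     : ∀ {a b} → a # b → b # a
      #-irrefl  : ∀ a → ¬ (a # a)
      ≤-finite  : ∀ e → ∃ λ (l : List Ev) → ∀ e' → e' ≤ e → e' ∈ l
      #-inherit : ∀ {e e' e''} → e # e' → e' ≤ e'' → e # e''

  Concurrent : Ev → Ev → Set
  Concurrent a b = ¬ (a ≤ b) × ¬ (b ≤ a) × ¬ (a # b)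

  _⇝_ : Ev → Ev → Set
  e₁ ⇝ e₂ = (e₁ # e₂) ×
    (∀ e₁' e₂' → e₁' ≤ e₁ → e₂' ≤ e₂ → e₁' # e₂' → (e₁' ≡ e₁) × (e₂' ≡ e₂))

  InBracket : Ev → Ev → Set
  InBracket e e' = (e' ≡ e) ⊎ (e ⇝ e')

module _ {c ℓ : Level} (S : StarCommRing c ℓ) (N : ℕ) where
  open Ops S N

  record IsUnitaryES (X : RawES) (Q : RawES.Ev X → Op) : Set (c ⊔ ℓ) where
    open RawES X
    field
      isES       : IsEventStructure X
      projOrUnit : ∀ e → IsProjection (Q e) ⊎ IsUnitary (Q e)
      concComm   : ∀ a b → Concurrent X a b → (Q a *ₒ Q b) ≈ₒ (Q b *ₒ Q a)
      ⇝-trans    : ∀ {a b d} → _⇝_ X a b → _⇝_ X b d → a ≢ d → _⇝_ X a d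
      bracketUnitary : ∀ e → ∃ λ (l : List Ev) →
        Unique l × (∀ x → (x ∈ l) ⇔ InBracket X e x) × IsUnitary (sumOps (map Q l))

data MEv (A B : Set) : Set where
  τ₀ τ₁ : MEv A B
  ι₁ : A → MEv A B
  ι₂ : B → MEv A B

module _ (X₁ X₂ : RawES) where
  private
    module X₁ = RawES X₁
    module X₂ = RawES X₂

  measLe : MEv X₁.Ev X₂.Ev → MEv X₁.Ev X₂.Ev → Set
  measLe τ₀ τ₀ = ⊤
  measLe τ₁ τ₁ = ⊤
  measLe τ₀ (ι₁ _) = ⊤
  measLe τ₁ (ι₂ _) = ⊤
  measLe (ι₁ a) (ι₁ b) = X₁._≤_ a b
  measLe (ι₂ a) (ι₂ b) = X₂._≤_ a b
  measLe _ _ = ⊥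

  measConf : MEv X₁.Ev X₂.Ev → MEv X₁.Ev X₂.Ev → Set
  measConf τ₀ τ₁ = ⊤
  measConf τ₀ (ι₂ _) = ⊤
  measConf (ι₁ _) τ₁ = ⊤
  measConf (ι₁ _) (ι₂ _) = ⊤
  measConf τ₁ τ₀ = ⊤
  measConf τ₁ (ι₁ _) = ⊤
  measConf (ι₂ _) τ₀ = ⊤
  measConf (ι₂ _) (ι₁ _) = ⊤
  measConf (ι₁ a) (ι₁ b) = X₁._#_ a b
  measConf (ι₂ a) (ι₂ b) = X₂._#_ a b
  measConf _ _ = ⊥

  measRaw : RawES
  measRaw = record { Ev = MEv X₁.Ev X₂.Ev ; _≤_ = measLe ; _#_ = measConf }

module _ {c ℓ : Level} (S : StarCommRing c ℓ) {N : ℕ} where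
  open Ops S N

  measQ : (n : Fin N) (X₁ X₂ : RawES) →
          (RawES.Ev X₁ → Op) → (RawES.Ev X₂ → Op) → MEv (RawES.Ev X₁) (RawES.Ev X₂) → Op
  measQ n X₁ X₂ Q₁ Q₂ τ₀ = P₀ n
  measQ n X₁ X₂ Q₁ Q₂ τ₁ = P₁ n
  measQ n X₁ X₂ Q₁ Q₂ (ι₁ a) = Q₁ a
  measQ n X₁ X₂ Q₁ Q₂ (ι₂ b) = Q₂ b

module Submission where

-- Every event of U₁ lies above τ₀, every event of U₂ above τ₁, and τ₀ # τ₁. A conflict
-- between the two branches therefore dominates τ₀ # τ₁, so the only minimal conflicts of
-- meas n (U₁, U₂) are τ₀ ⇝ τ₁, τ₁ ⇝ τ₀ and the minimal conflicts inside U₁ or U₂, and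
-- concurrent events lie in the same branch. Hence every axiom is inherited from U₁ or U₂,
-- except at [τ₀] = [τ₁] = {τ₀, τ₁}, whose operator sum P₀ⁿ + P₁ⁿ is the identity.

open import Defs
open import Level using (Level)
open import Data.Nat using (ℕ; zero; suc)
open import Data.Fin using (Fin; toℕ)
import Data.Fin as Fin
open import Data.Bool using (Bool; true; false; not; if_then_else_; _∧_)
import Data.Bool as Bool
open import Data.List using (List; []; _∷_; map)
open import Data.List.Membership.Propositional using (_∈_)
open import Data.List.Membership.Propositional.Properties using (∈-map⁺; map-∈↔)
open import Data.List.Relation.Unary.Any using (here; there)
open import Data.List.Relation.Unary.All using ([]; _∷_)
open import Data.List.Relation.Unary.AllPairs using ([]; _∷_)
open import Data.List.Relation.Unary.Unique.Propositional using (Unique)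
import Data.List.Relation.Unary.Unique.Propositional.Properties as Unique
open import Data.List.Properties using (map-∘)
open import Data.Product using (∃; _×_; _,_; map₁; map₂) renaming (map to map-×)
open import Data.Sum using (_⊎_; inj₁; inj₂)
open import Data.Empty using (⊥-elim)
open import Data.Unit using (tt)
open import Function using (_∘_)
open import Function.Bundles using (_⇔_; mk⇔; Equivalence)
import Function.Properties.Equivalence as ⇔
open import Function.Properties.Inverse using (↔⇒⇔)
open import Relation.Nullary using (¬_; does; yes; no)
open import Relation.Binary.PropositionalEquality as ≡ using (_≡_; _≢_)

module OperatorAlgebra {c ℓ : Level} (S : StarCommRing c ℓ) (N : ℕ) where
  open StarCommRing S
  open Ops S N
  open import Relation.Binary.Reasoning.Setoid setoid
  open import Algebra.Properties.Group +-group using (identityʳ-unique)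

  ⟦_⟧ : Bool → Carrier
  ⟦ b ⟧ = if b then 1# else 0#

  δ : ∀ {m} → Fin m → Fin m → Carrier
  δ i j = ⟦ does (i Fin.≟ j) ⟧

  conj-0# : conj 0# ≈ 0#
  conj-0# = identityʳ-unique (conj 0#) (conj 0#) (begin
    conj 0# + conj 0#  ≈⟨ sym (conj-+ 0# 0#) ⟩
    conj (0# + 0#)     ≈⟨ conj-cong (+-identityʳ 0#) ⟩
    conj 0#            ∎)

  conj-⟦⟧ : ∀ b → conj ⟦ b ⟧ ≈ ⟦ b ⟧
  conj-⟦⟧ true  = conj-1
  conj-⟦⟧ false = conj-0#

  ⟦⟧-idem : ∀ b → ⟦ b ⟧ * ⟦ b ⟧ ≈ ⟦ b ⟧
  ⟦⟧-idem true  = *-identityˡ 1#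
  ⟦⟧-idem false = zeroˡ 0#

  ⟦⟧+⟦not⟧ : ∀ b → ⟦ b ⟧ + ⟦ not b ⟧ ≈ 1#
  ⟦⟧+⟦not⟧ true  = +-identityʳ 1#
  ⟦⟧+⟦not⟧ false = +-identityˡ 1#

  δ-sym : ∀ {m} (i j : Fin m) → δ i j ≈ δ j i
  δ-sym i j with i Fin.≟ j | j Fin.≟ i
  ... | yes _   | yes _   = refl
  ... | no _    | no _    = refl
  ... | yes i≡j | no j≢i  = ⊥-elim (j≢i (≡.sym i≡j))
  ... | no i≢j  | yes j≡i = ⊥-elim (i≢j (≡.sym j≡i))

  sumFin-cong : ∀ {m} {f g : Fin m → Carrier} → (∀ k → f k ≈ g k) → sumFin f ≈ sumFin g
  sumFin-cong {zero}  f≈g = refl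
  sumFin-cong {suc m} f≈g = +-cong (f≈g Fin.zero) (sumFin-cong (f≈g ∘ Fin.suc))

  sumFin-zero : ∀ {m} {f : Fin m → Carrier} → (∀ k → f k ≈ 0#) → sumFin f ≈ 0#
  sumFin-zero {zero}  f≈0 = refl
  sumFin-zero {suc m} f≈0 =
    trans (+-cong (f≈0 Fin.zero) (sumFin-zero (f≈0 ∘ Fin.suc))) (+-identityʳ 0#)

  sumFin-δ : ∀ {m} (i : Fin m) (f : Fin m → Carrier) → sumFin (λ k → δ i k * f k) ≈ f i
  sumFin-δ Fin.zero f = begin
    1# * f Fin.zero + sumFin (λ k → 0# * f (Fin.suc k))
      ≈⟨ +-cong (*-identityˡ _) (sumFin-zero (λ k → zeroˡ (f (Fin.suc k)))) ⟩
    f Fin.zero + 0#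
      ≈⟨ +-identityʳ _ ⟩
    f Fin.zero ∎
  sumFin-δ (Fin.suc i) f = begin
    0# * f Fin.zero + sumFin (λ k → δ i k * f (Fin.suc k))
      ≈⟨ +-cong (zeroˡ _) (sumFin-δ i (f ∘ Fin.suc)) ⟩
    0# + f (Fin.suc i)
      ≈⟨ +-identityˡ _ ⟩
    f (Fin.suc i) ∎

  ≈Idₒ⇒isUnitary : ∀ {A} → A ≈ₒ Idₒ → IsUnitary A
  ≈Idₒ⇒isUnitary {A} A≈Id = adj-A*A , A*adj-A
    where
    conj-entry : ∀ k i → conj (A k i) ≈ δ i k
    conj-entry k i = trans (conj-cong (A≈Id k i)) (trans (conj-⟦⟧ _) (δ-sym k i))

    adj-A*A : adj A *ₒ A ≈ₒ Idₒ
    adj-A*A i j = begin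
      sumFin (λ k → conj (A k i) * A k j)
        ≈⟨ sumFin-cong (λ k → *-cong (conj-entry k i) (A≈Id k j)) ⟩
      sumFin (λ k → δ i k * δ k j)
        ≈⟨ sumFin-δ i (λ k → δ k j) ⟩
      δ i j ∎

    A*adj-A : A *ₒ adj A ≈ₒ Idₒ
    A*adj-A i j = begin
      sumFin (λ k → A i k * conj (A j k))
        ≈⟨ sumFin-cong (λ k → *-cong (A≈Id i k) (conj-entry j k)) ⟩
      sumFin (λ k → δ i k * δ k j)
        ≈⟨ sumFin-δ i (λ k → δ k j) ⟩
      δ i j ∎

  diagₒ : (Fin Dim → Bool) → Op
  diagₒ d i j = ⟦ does (i Fin.≟ j) ∧ d i ⟧

  diagₒ-entry : ∀ d i j → diagₒ d i j ≈ δ i j * ⟦ d i ⟧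
  diagₒ-entry d i j with i Fin.≟ j
  ... | yes _ = sym (*-identityˡ _)
  ... | no _  = sym (zeroˡ _)

  diagₒ-sym : ∀ d i j → diagₒ d i j ≈ diagₒ d j i
  diagₒ-sym d i j with i Fin.≟ j | j Fin.≟ i
  ... | yes ≡.refl | yes _   = refl
  ... | no _       | no _    = refl
  ... | yes i≡j    | no j≢i  = ⊥-elim (j≢i (≡.sym i≡j))
  ... | no i≢j     | yes j≡i = ⊥-elim (i≢j (≡.sym j≡i))

  diagₒ-isProjection : ∀ d → IsProjection (diagₒ d)
  diagₒ-isProjection d = idempotent , selfAdjoint
    where
    absorb : ∀ i j → ⟦ d i ⟧ * diagₒ d i j ≈ diagₒ d i j
    absorb i j = begin
      ⟦ d i ⟧ * diagₒ d i j      ≈⟨ *-congˡ (diagₒ-entry d i j) ⟩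
      ⟦ d i ⟧ * (δ i j * ⟦ d i ⟧) ≈⟨ *-congˡ (*-comm _ _) ⟩
      ⟦ d i ⟧ * (⟦ d i ⟧ * δ i j) ≈⟨ sym (*-assoc _ _ _) ⟩
      ⟦ d i ⟧ * ⟦ d i ⟧ * δ i j   ≈⟨ *-congʳ (⟦⟧-idem (d i)) ⟩
      ⟦ d i ⟧ * δ i j             ≈⟨ *-comm _ _ ⟩
      δ i j * ⟦ d i ⟧             ≈⟨ sym (diagₒ-entry d i j) ⟩
      diagₒ d i j                 ∎

    idempotent : diagₒ d *ₒ diagₒ d ≈ₒ diagₒ d
    idempotent i j = begin
      sumFin (λ k → diagₒ d i k * diagₒ d k j)
        ≈⟨ sumFin-cong (λ k → trans (*-congʳ (diagₒ-entry d i k)) (*-assoc _ _ _)) ⟩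
      sumFin (λ k → δ i k * (⟦ d i ⟧ * diagₒ d k j))
        ≈⟨ sumFin-δ i (λ k → ⟦ d i ⟧ * diagₒ d k j) ⟩
      ⟦ d i ⟧ * diagₒ d i j
        ≈⟨ absorb i j ⟩
      diagₒ d i j ∎

    selfAdjoint : adj (diagₒ d) ≈ₒ diagₒ d
    selfAdjoint i j = trans (conj-⟦⟧ _) (diagₒ-sym d j i)

  diagₒ-complement : ∀ d d′ → (∀ i → d′ i ≡ not (d i)) → diagₒ d +ₒ diagₒ d′ ≈ₒ Idₒ
  diagₒ-complement d d′ d′≡not-d i j rewrite d′≡not-d i with i Fin.≟ j
  ... | yes _ = ⟦⟧+⟦not⟧ (d i)
  ... | no _  = +-identityˡ 0#

  -- Proj b n is definitionally diagₒ (qubitIs b n).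
  qubitIs : Bool → Fin N → Fin Dim → Bool
  qubitIs b n i = does (bitAt (toℕ i) (toℕ n) Bool.≟ b)

  Proj-isProjection : ∀ b n → IsProjection (Proj b n)
  Proj-isProjection b n = diagₒ-isProjection (qubitIs b n)

  Proj-complement : ∀ b n → Proj b n +ₒ Proj (not b) n ≈ₒ Idₒ
  Proj-complement b n =
    diagₒ-complement (qubitIs b n) (qubitIs (not b) n) (λ i → ≟-not (bitAt (toℕ i) (toℕ n)) b)
    where
    ≟-not : ∀ x y → does (x Bool.≟ not y) ≡ not (does (x Bool.≟ y))
    ≟-not false false = ≡.refl
    ≟-not false true  = ≡.refl
    ≟-not true  false = ≡.refl
    ≟-not true  true  = ≡.refl

module Measurement (X₁ X₂ : RawES) where
  private
    module X₁ = RawES X₁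
    module X₂ = RawES X₂

  M : RawES
  M = measRaw X₁ X₂

  open RawES M using (Ev; _≤_; _#_)

  ι₁-injective : ∀ {a b} → _≡_ {A = Ev} (ι₁ a) (ι₁ b) → a ≡ b
  ι₁-injective ≡.refl = ≡.refl

  ι₂-injective : ∀ {a b} → _≡_ {A = Ev} (ι₂ a) (ι₂ b) → a ≡ b
  ι₂-injective ≡.refl = ≡.refl

  meas-isEventStructure : IsEventStructure X₁ → IsEventStructure X₂ → IsEventStructure M
  meas-isEventStructure E₁ E₂ = record
    { ≤-refl    = reflexive
    ; ≤-trans   = λ {a} {b} {d} → transitive a b d
    ; ≤-antisym = λ {a} {b} → antisymmetric a b
    ; #-sym     = λ {a} {b} → symmetric a b
    ; #-irrefl  = irreflexive
    ; ≤-finite  = finite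
    ; #-inherit = λ {e} {e′} {e″} → inherit e e′ e″
    }
    where
    module E₁ = IsEventStructure E₁
    module E₂ = IsEventStructure E₂

    reflexive : ∀ e → e ≤ e
    reflexive τ₀     = tt
    reflexive τ₁     = tt
    reflexive (ι₁ a) = E₁.≤-refl a
    reflexive (ι₂ a) = E₂.≤-refl a

    transitive : ∀ a b d → a ≤ b → b ≤ d → a ≤ d
    transitive τ₀     τ₀     d      _   b≤d = b≤d
    transitive τ₁     τ₁     d      _   b≤d = b≤d
    transitive τ₀     (ι₁ _) (ι₁ _) _   _   = tt
    transitive τ₁     (ι₂ _) (ι₂ _) _   _   = tt
    transitive (ι₁ _) (ι₁ _) (ι₁ _) a≤b b≤d = E₁.≤-trans a≤b b≤d
    transitive (ι₂ _) (ι₂ _) (ι₂ _) a≤b b≤d = E₂.≤-trans a≤b b≤d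

    antisymmetric : ∀ a b → a ≤ b → b ≤ a → a ≡ b
    antisymmetric τ₀     τ₀     _   _   = ≡.refl
    antisymmetric τ₁     τ₁     _   _   = ≡.refl
    antisymmetric (ι₁ _) (ι₁ _) a≤b b≤a = ≡.cong ι₁ (E₁.≤-antisym a≤b b≤a)
    antisymmetric (ι₂ _) (ι₂ _) a≤b b≤a = ≡.cong ι₂ (E₂.≤-antisym a≤b b≤a)

    symmetric : ∀ a b → a # b → b # a
    symmetric τ₀     τ₁     _   = tt
    symmetric τ₀     (ι₂ _) _   = tt
    symmetric τ₁     τ₀     _   = tt
    symmetric τ₁     (ι₁ _) _   = tt
    symmetric (ι₁ _) τ₁     _   = tt
    symmetric (ι₁ _) (ι₁ _) a#b = E₁.#-sym a#b
    symmetric (ι₁ _) (ι₂ _) _   = tt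
    symmetric (ι₂ _) τ₀     _   = tt
    symmetric (ι₂ _) (ι₁ _) _   = tt
    symmetric (ι₂ _) (ι₂ _) a#b = E₂.#-sym a#b

    irreflexive : ∀ e → ¬ (e # e)
    irreflexive τ₀     ()
    irreflexive τ₁     ()
    irreflexive (ι₁ a) = E₁.#-irrefl a
    irreflexive (ι₂ a) = E₂.#-irrefl a

    finite : ∀ e → ∃ λ (l : List Ev) → ∀ e′ → e′ ≤ e → e′ ∈ l
    finite τ₀ = τ₀ ∷ [] , λ { τ₀ _ → here ≡.refl }
    finite τ₁ = τ₁ ∷ [] , λ { τ₁ _ → here ≡.refl }
    finite (ι₁ a) with E₁.≤-finite a
    ... | l , below = τ₀ ∷ map ι₁ l ,
      λ { τ₀ _ → here ≡.refl ; (ι₁ b) b≤a → there (∈-map⁺ ι₁ (below b b≤a)) }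
    finite (ι₂ a) with E₂.≤-finite a
    ... | l , below = τ₁ ∷ map ι₂ l ,
      λ { τ₁ _ → here ≡.refl ; (ι₂ b) b≤a → there (∈-map⁺ ι₂ (below b b≤a)) }

    inherit : ∀ e e′ e″ → e # e′ → e′ ≤ e″ → e # e″
    inherit e      τ₀     τ₀     e#e′ _     = e#e′
    inherit e      τ₁     τ₁     e#e′ _     = e#e′
    inherit τ₁     τ₀     (ι₁ _) _    _     = tt
    inherit (ι₂ _) τ₀     (ι₁ _) _    _     = tt
    inherit τ₀     τ₁     (ι₂ _) _    _     = tt
    inherit (ι₁ _) τ₁     (ι₂ _) _    _     = tt
    inherit τ₁     (ι₁ _) (ι₁ _) _    _     = tt
    inherit (ι₂ _) (ι₁ _) (ι₁ _) _    _     = tt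
    inherit (ι₁ _) (ι₁ _) (ι₁ _) e#e′ e′≤e″ = E₁.#-inherit e#e′ e′≤e″
    inherit τ₀     (ι₂ _) (ι₂ _) _    _     = tt
    inherit (ι₁ _) (ι₂ _) (ι₂ _) _    _     = tt
    inherit (ι₂ _) (ι₂ _) (ι₂ _) e#e′ e′≤e″ = E₂.#-inherit e#e′ e′≤e″

  data BranchConcurrent : Ev → Ev → Set where
    concurrent₁ : ∀ {a b} → Concurrent X₁ a b → BranchConcurrent (ι₁ a) (ι₁ b)
    concurrent₂ : ∀ {a b} → Concurrent X₂ a b → BranchConcurrent (ι₂ a) (ι₂ b)

  concurrent⇒branchConcurrent : ∀ a b → Concurrent M a b → BranchConcurrent a b
  concurrent⇒branchConcurrent τ₀     τ₀     (a≰b , _)        = ⊥-elim (a≰b tt)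
  concurrent⇒branchConcurrent τ₀     τ₁     (_ , _ , ¬a#b)   = ⊥-elim (¬a#b tt)
  concurrent⇒branchConcurrent τ₀     (ι₁ _) (a≰b , _)        = ⊥-elim (a≰b tt)
  concurrent⇒branchConcurrent τ₀     (ι₂ _) (_ , _ , ¬a#b)   = ⊥-elim (¬a#b tt)
  concurrent⇒branchConcurrent τ₁     τ₀     (_ , _ , ¬a#b)   = ⊥-elim (¬a#b tt)
  concurrent⇒branchConcurrent τ₁     τ₁     (a≰b , _)        = ⊥-elim (a≰b tt)
  concurrent⇒branchConcurrent τ₁     (ι₁ _) (_ , _ , ¬a#b)   = ⊥-elim (¬a#b tt)
  concurrent⇒branchConcurrent τ₁     (ι₂ _) (a≰b , _)        = ⊥-elim (a≰b tt)
  concurrent⇒branchConcurrent (ι₁ _) τ₀     (_ , b≰a , _)    = ⊥-elim (b≰a tt)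
  concurrent⇒branchConcurrent (ι₁ _) τ₁     (_ , _ , ¬a#b)   = ⊥-elim (¬a#b tt)
  concurrent⇒branchConcurrent (ι₁ _) (ι₁ _) a∥b              = concurrent₁ a∥b
  concurrent⇒branchConcurrent (ι₁ _) (ι₂ _) (_ , _ , ¬a#b)   = ⊥-elim (¬a#b tt)
  concurrent⇒branchConcurrent (ι₂ _) τ₀     (_ , _ , ¬a#b)   = ⊥-elim (¬a#b tt)
  concurrent⇒branchConcurrent (ι₂ _) τ₁     (_ , b≰a , _)    = ⊥-elim (b≰a tt)
  concurrent⇒branchConcurrent (ι₂ _) (ι₁ _) (_ , _ , ¬a#b)   = ⊥-elim (¬a#b tt)
  concurrent⇒branchConcurrent (ι₂ _) (ι₂ _) a∥b              = concurrent₂ a∥b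

  infix 4 _⇝ₘ_ _⇝₁_ _⇝₂_
  _⇝ₘ_ : Ev → Ev → Set
  _⇝ₘ_ = Defs._⇝_ M
  _⇝₁_ : X₁.Ev → X₁.Ev → Set
  _⇝₁_ = Defs._⇝_ X₁
  _⇝₂_ : X₂.Ev → X₂.Ev → Set
  _⇝₂_ = Defs._⇝_ X₂

  data MinimalConflict : Ev → Ev → Set where
    τ₀⇝τ₁ : MinimalConflict τ₀ τ₁
    τ₁⇝τ₀ : MinimalConflict τ₁ τ₀
    ι₁⇝ι₁ : ∀ {a b} → a ⇝₁ b → MinimalConflict (ι₁ a) (ι₁ b)
    ι₂⇝ι₂ : ∀ {a b} → a ⇝₂ b → MinimalConflict (ι₂ a) (ι₂ b)

  MinimalConflict⇒⇝ : ∀ {a b} → MinimalConflict a b → a ⇝ₘ b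
  MinimalConflict⇒⇝ τ₀⇝τ₁ = tt , λ { τ₀ τ₁ _ _ _ → ≡.refl , ≡.refl }
  MinimalConflict⇒⇝ τ₁⇝τ₀ = tt , λ { τ₁ τ₀ _ _ _ → ≡.refl , ≡.refl }
  MinimalConflict⇒⇝ (ι₁⇝ι₁ (a#b , minimal)) = a#b , λ
    { (ι₁ a′) (ι₁ b′) a′≤a b′≤b a′#b′ →
        map-× (≡.cong ι₁) (≡.cong ι₁) (minimal a′ b′ a′≤a b′≤b a′#b′)
    ; τ₀ τ₀ _ _ () ; τ₀ (ι₁ _) _ _ () ; (ι₁ _) τ₀ _ _ () }
  MinimalConflict⇒⇝ (ι₂⇝ι₂ (a#b , minimal)) = a#b , λ
    { (ι₂ a′) (ι₂ b′) a′≤a b′≤b a′#b′ →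
        map-× (≡.cong ι₂) (≡.cong ι₂) (minimal a′ b′ a′≤a b′≤b a′#b′)
    ; τ₁ τ₁ _ _ () ; τ₁ (ι₂ _) _ _ () ; (ι₂ _) τ₁ _ _ () }

  ⇝⇒MinimalConflict : ∀ {a b} → a ⇝ₘ b → MinimalConflict a b
  ⇝⇒MinimalConflict {τ₀}   {τ₀}   (() , _)
  ⇝⇒MinimalConflict {τ₀}   {τ₁}   _ = τ₀⇝τ₁
  ⇝⇒MinimalConflict {τ₀}   {ι₁ _} (() , _)
  ⇝⇒MinimalConflict {τ₀}   {ι₂ _} (_ , minimal) with minimal τ₀ τ₁ tt tt tt
  ... | _ , ()
  ⇝⇒MinimalConflict {τ₁}   {τ₀}   _ = τ₁⇝τ₀
  ⇝⇒MinimalConflict {τ₁}   {τ₁}   (() , _)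
  ⇝⇒MinimalConflict {τ₁}   {ι₁ _} (_ , minimal) with minimal τ₁ τ₀ tt tt tt
  ... | _ , ()
  ⇝⇒MinimalConflict {τ₁}   {ι₂ _} (() , _)
  ⇝⇒MinimalConflict {ι₁ _} {τ₀}   (() , _)
  ⇝⇒MinimalConflict {ι₁ _} {τ₁}   (_ , minimal) with minimal τ₀ τ₁ tt tt tt
  ... | () , _
  ⇝⇒MinimalConflict {ι₁ _} {ι₁ _} (a#b , minimal) = ι₁⇝ι₁ (a#b , λ a′ b′ a′≤a b′≤b a′#b′ →
    map-× ι₁-injective ι₁-injective (minimal (ι₁ a′) (ι₁ b′) a′≤a b′≤b a′#b′))
  ⇝⇒MinimalConflict {ι₁ _} {ι₂ _} (_ , minimal) with minimal τ₀ τ₁ tt tt tt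
  ... | () , _
  ⇝⇒MinimalConflict {ι₂ _} {τ₀}   (_ , minimal) with minimal τ₁ τ₀ tt tt tt
  ... | () , _
  ⇝⇒MinimalConflict {ι₂ _} {τ₁}   (() , _)
  ⇝⇒MinimalConflict {ι₂ _} {ι₁ _} (_ , minimal) with minimal τ₁ τ₀ tt tt tt
  ... | () , _
  ⇝⇒MinimalConflict {ι₂ _} {ι₂ _} (a#b , minimal) = ι₂⇝ι₂ (a#b , λ a′ b′ a′≤a b′≤b a′#b′ →
    map-× ι₂-injective ι₂-injective (minimal (ι₂ a′) (ι₂ b′) a′≤a b′≤b a′#b′))

  ⇝-trans : (∀ {a b d} → a ⇝₁ b → b ⇝₁ d → a ≢ d → a ⇝₁ d) →
            (∀ {a b d} → a ⇝₂ b → b ⇝₂ d → a ≢ d → a ⇝₂ d) →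
            ∀ {a b d} → a ⇝ₘ b → b ⇝ₘ d → a ≢ d → a ⇝ₘ d
  ⇝-trans trans₁ trans₂ a⇝b b⇝d =
    compose (⇝⇒MinimalConflict a⇝b) (⇝⇒MinimalConflict b⇝d)
    where
    compose : ∀ {a b d} → MinimalConflict a b → MinimalConflict b d → a ≢ d → a ⇝ₘ d
    compose τ₀⇝τ₁ τ₁⇝τ₀ a≢d = ⊥-elim (a≢d ≡.refl)
    compose τ₁⇝τ₀ τ₀⇝τ₁ a≢d = ⊥-elim (a≢d ≡.refl)
    compose (ι₁⇝ι₁ a⇝b) (ι₁⇝ι₁ b⇝d) a≢d =
      MinimalConflict⇒⇝ (ι₁⇝ι₁ (trans₁ a⇝b b⇝d (a≢d ∘ ≡.cong ι₁)))
    compose (ι₂⇝ι₂ a⇝b) (ι₂⇝ι₂ b⇝d) a≢d =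
      MinimalConflict⇒⇝ (ι₂⇝ι₂ (trans₂ a⇝b b⇝d (a≢d ∘ ≡.cong ι₂)))

  inBracket-τ₀ : ∀ x → x ∈ τ₀ ∷ τ₁ ∷ [] ⇔ InBracket M τ₀ x
  inBracket-τ₀ x = mk⇔ to from
    where
    to : x ∈ τ₀ ∷ τ₁ ∷ [] → InBracket M τ₀ x
    to (here ≡.refl)         = inj₁ ≡.refl
    to (there (here ≡.refl)) = inj₂ (MinimalConflict⇒⇝ τ₀⇝τ₁)
    to (there (there ()))

    from : InBracket M τ₀ x → x ∈ τ₀ ∷ τ₁ ∷ []
    from (inj₁ ≡.refl) = here ≡.refl
    from (inj₂ τ₀⇝x) with ⇝⇒MinimalConflict τ₀⇝x
    ... | τ₀⇝τ₁ = there (here ≡.refl)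

  inBracket-τ₁ : ∀ x → x ∈ τ₁ ∷ τ₀ ∷ [] ⇔ InBracket M τ₁ x
  inBracket-τ₁ x = mk⇔ to from
    where
    to : x ∈ τ₁ ∷ τ₀ ∷ [] → InBracket M τ₁ x
    to (here ≡.refl)         = inj₁ ≡.refl
    to (there (here ≡.refl)) = inj₂ (MinimalConflict⇒⇝ τ₁⇝τ₀)
    to (there (there ()))

    from : InBracket M τ₁ x → x ∈ τ₁ ∷ τ₀ ∷ []
    from (inj₁ ≡.refl) = here ≡.refl
    from (inj₂ τ₁⇝x) with ⇝⇒MinimalConflict τ₁⇝x
    ... | τ₁⇝τ₀ = there (here ≡.refl)

  inBracket-ι₁ : ∀ e x → InBracket M (ι₁ e) x ⇔ ∃ λ y → InBracket X₁ e y × x ≡ ι₁ y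
  inBracket-ι₁ e x = mk⇔ to from
    where
    to : InBracket M (ι₁ e) x → ∃ λ y → InBracket X₁ e y × x ≡ ι₁ y
    to (inj₁ ≡.refl) = e , inj₁ ≡.refl , ≡.refl
    to (inj₂ e⇝x) with ⇝⇒MinimalConflict e⇝x
    ... | ι₁⇝ι₁ e⇝y = _ , inj₂ e⇝y , ≡.refl

    from : (∃ λ y → InBracket X₁ e y × x ≡ ι₁ y) → InBracket M (ι₁ e) x
    from (_ , inj₁ ≡.refl , ≡.refl) = inj₁ ≡.refl
    from (_ , inj₂ e⇝y , ≡.refl)    = inj₂ (MinimalConflict⇒⇝ (ι₁⇝ι₁ e⇝y))

  inBracket-ι₂ : ∀ e x → InBracket M (ι₂ e) x ⇔ ∃ λ y → InBracket X₂ e y × x ≡ ι₂ y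
  inBracket-ι₂ e x = mk⇔ to from
    where
    to : InBracket M (ι₂ e) x → ∃ λ y → InBracket X₂ e y × x ≡ ι₂ y
    to (inj₁ ≡.refl) = e , inj₁ ≡.refl , ≡.refl
    to (inj₂ e⇝x) with ⇝⇒MinimalConflict e⇝x
    ... | ι₂⇝ι₂ e⇝y = _ , inj₂ e⇝y , ≡.refl

    from : (∃ λ y → InBracket X₂ e y × x ≡ ι₂ y) → InBracket M (ι₂ e) x
    from (_ , inj₁ ≡.refl , ≡.refl) = inj₁ ≡.refl
    from (_ , inj₂ e⇝y , ≡.refl)    = inj₂ (MinimalConflict⇒⇝ (ι₂⇝ι₂ e⇝y))

module UnitaryBrackets {c ℓ : Level} (S : StarCommRing c ℓ) (N : ℕ) where
  open StarCommRing S using (+-congˡ; +-identityʳ; trans)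
  open Ops S N
  open OperatorAlgebra S N using (≈Idₒ⇒isUnitary)

  HasUnitaryBracket : (X : RawES) → (RawES.Ev X → Op) → RawES.Ev X → Set ℓ
  HasUnitaryBracket X Q e = ∃ λ (l : List (RawES.Ev X)) →
    Unique l × (∀ x → (x ∈ l) ⇔ InBracket X e x) × IsUnitary (sumOps (map Q l))

  hasUnitaryBracket-pair : ∀ {X Q e} {x y : RawES.Ev X} → x ≢ y →
    (∀ z → z ∈ x ∷ y ∷ [] ⇔ InBracket X e z) → Q x +ₒ Q y ≈ₒ Idₒ →
    HasUnitaryBracket X Q e
  hasUnitaryBracket-pair x≢y enumerates Qx+Qy≈Id =
    _ , (x≢y ∷ []) ∷ [] ∷ [] , enumerates ,
    ≈Idₒ⇒isUnitary (λ i j → trans (+-congˡ (+-identityʳ _)) (Qx+Qy≈Id i j))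

  hasUnitaryBracket-map : ∀ {X Y} {Q : RawES.Ev Y → Op} (f : RawES.Ev X → RawES.Ev Y) →
    (∀ {x y} → f x ≡ f y → x ≡ y) →
    ∀ {e} → (∀ y → InBracket Y (f e) y ⇔ ∃ λ x → InBracket X e x × y ≡ f x) →
    HasUnitaryBracket X (Q ∘ f) e → HasUnitaryBracket Y Q (f e)
  hasUnitaryBracket-map {X} {Y} f f-injective {e} inBracket-f (l , unique , enumerates , unitary) =
    map f l , Unique.map⁺ f-injective unique , enumerates-f ,
    ≡.subst IsUnitary (≡.cong sumOps (map-∘ l)) unitary
    where
    enumerates-f : ∀ y → y ∈ map f l ⇔ InBracket Y (f e) y
    enumerates-f y = ⇔.trans (⇔.sym (↔⇒⇔ (map-∈↔ f))) (⇔.trans via-l (⇔.sym (inBracket-f y)))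
      where
      via-l : (∃ λ x → x ∈ l × y ≡ f x) ⇔ (∃ λ x → InBracket X e x × y ≡ f x)
      via-l = mk⇔ (map₂ λ {x} → map₁ (Equivalence.to (enumerates x)))
                  (map₂ λ {x} → map₁ (Equivalence.from (enumerates x)))

mainTheorem13 : ∀ {c ℓ : Level} (S : StarCommRing c ℓ) (N : ℕ)
    (X₁ X₂ : RawES)
    (Q₁ : RawES.Ev X₁ → Ops.Op S N) (Q₂ : RawES.Ev X₂ → Ops.Op S N) →
    IsUnitaryES S N X₁ Q₁ → IsUnitaryES S N X₂ Q₂ →
    (n : Fin N) →
    IsUnitaryES S N (measRaw X₁ X₂) (measQ S n X₁ X₂ Q₁ Q₂)
mainTheorem13 S N X₁ X₂ Q₁ Q₂ U₁ U₂ n = record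
  { isES           = meas-isEventStructure U₁.isES U₂.isES
  ; projOrUnit     = projOrUnit
  ; concComm       = λ a b a∥b → concComm (concurrent⇒branchConcurrent a b a∥b)
  ; ⇝-trans        = ⇝-trans U₁.⇝-trans U₂.⇝-trans
  ; bracketUnitary = bracketUnitary
  }
  where
  open Ops S N
  open OperatorAlgebra S N using (Proj-isProjection; Proj-complement)
  open UnitaryBrackets S N
  open Measurement X₁ X₂
  module U₁ = IsUnitaryES U₁
  module U₂ = IsUnitaryES U₂

  Q : RawES.Ev M → Op
  Q = measQ S n X₁ X₂ Q₁ Q₂

  projOrUnit : ∀ e → IsProjection (Q e) ⊎ IsUnitary (Q e)
  projOrUnit τ₀     = inj₁ (Proj-isProjection false n)
  projOrUnit τ₁     = inj₁ (Proj-isProjection true n)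
  projOrUnit (ι₁ e) = U₁.projOrUnit e
  projOrUnit (ι₂ e) = U₂.projOrUnit e

  concComm : ∀ {a b} → BranchConcurrent a b → Q a *ₒ Q b ≈ₒ Q b *ₒ Q a
  concComm (concurrent₁ a∥b) = U₁.concComm _ _ a∥b
  concComm (concurrent₂ a∥b) = U₂.concComm _ _ a∥b

  bracketUnitary : ∀ e → HasUnitaryBracket M Q e
  bracketUnitary τ₀     = hasUnitaryBracket-pair (λ ()) inBracket-τ₀ (Proj-complement false n)
  bracketUnitary τ₁     = hasUnitaryBracket-pair (λ ()) inBracket-τ₁ (Proj-complement true n)
  bracketUnitary (ι₁ e) =
    hasUnitaryBracket-map ι₁ ι₁-injective (inBracket-ι₁ e) (U₁.bracketUnitary e)
  bracketUnitary (ι₂ e) =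
    hasUnitaryBracket-map ι₂ ι₂-injective (inBracket-ι₂ e) (U₂.bracketUnitary e)
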